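{- Let $q$ be a prime power and $n\ge 2$ an integer. The girth of the bipartite graph $G(n,q)$ is $8$.
   Context: $\mathbb{S}_n(\mathbb{F}_q)$ denotes the set of $n\times n$ symmetric matrices over $\mathbb{F}_q$ (its elements are called points). Two points $S,S'$ are adjacent if $\operatorname{rank}(S-S')=1$. A line is a maximal set of rank $1$: a subset $\mathcal{M}\subseteq\mathbb{S}_n(\mathbb{F}_q)$ such that any two distinct points of $\mathcal{M}$ are adjacent and no point of $\mathbb{S}_n(\mathbb{F}_q)\setminus\mathcal{M}$ is adjacent to every point of $\mathcal{M}$. $G(n,q)$ is the bipartite graph whose vertex set is the disjoint union of the set of points and the set of lines, with a point joined to a line if and only if the point belongs to the line. -}

module Defs where

open import Level using (Level; _⊔_; Lift) renaming (suc to lsuc)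
open import Algebra.Bundles using (CommutativeRing)
open import Data.Nat using (ℕ; zero; suc; _≤_; _<_; _^_)
open import Data.Nat.Primality using (Prime)
open import Data.Fin using (Fin; zero; suc; inject₁; fromℕ)
open import Data.Product using (Σ; _×_; _,_; proj₁)
open import Data.Sum using (_⊎_; inj₁; inj₂)
open import Data.Empty using (⊥)
open import Relation.Nullary using (¬_)
open import Relation.Binary.PropositionalEquality using (_≡_)

IsPrimePower : ℕ → Set
IsPrimePower q = Σ ℕ λ p → Σ ℕ λ k → Prime p × 1 ≤ k × q ≡ p ^ k

module _ {c ℓ} (R : CommutativeRing c ℓ) where
  open CommutativeRing R using (Carrier; _≈_; _+_; _*_; 0#; 1#)

  record IsField : Set (c ⊔ ℓ) where
    field
      0≉1 : ¬ (0# ≈ 1#)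
      inverse : ∀ x → ¬ (x ≈ 0#) → Σ Carrier λ y → x * y ≈ 1#

  HasCardinality : ℕ → Set (c ⊔ ℓ)
  HasCardinality q = Σ (Fin q → Carrier) λ e →
    (∀ i j → e i ≈ e j → i ≡ j) × (∀ x → Σ (Fin q) λ i → e i ≈ x)

  ∑ : ∀ k → (Fin k → Carrier) → Carrier
  ∑ zero f = 0#
  ∑ (suc k) f = f zero + ∑ k (λ i → f (suc i))

module Sym {c ℓ} (R : CommutativeRing c ℓ) (n : ℕ) where
  open CommutativeRing R using (Carrier; _≈_; _-_; _*_; 0#)

  Mat : Set c
  Mat = Fin n → Fin n → Carrier

  IndependentRows : Mat → ∀ k → (Fin k → Fin n) → Set (c ⊔ ℓ)
  IndependentRows M k ι = (∀ i i' → ι i ≡ ι i' → i ≡ i') ×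
    (∀ (a : Fin k → Carrier) → (∀ j → ∑ R k (λ i → a i * M (ι i) j) ≈ 0#) → ∀ i → a i ≈ 0#)

  HasRank : Mat → ℕ → Set (c ⊔ ℓ)
  HasRank M r = (Σ (Fin r → Fin n) λ ι → IndependentRows M r ι) ×
    (∀ (ι : Fin (suc r) → Fin n) → ¬ IndependentRows M (suc r) ι)

  Point : Set (c ⊔ ℓ)
  Point = Σ Mat λ S → ∀ i j → S i j ≈ S j i

  _≈P_ : Point → Point → Set ℓ
  S ≈P T = ∀ i j → proj₁ S i j ≈ proj₁ T i j

  Adjacent : Point → Point → Set (c ⊔ ℓ)
  Adjacent S T = HasRank (λ i j → proj₁ S i j - proj₁ T i j) 1

  PointSet : Set (lsuc (c ⊔ ℓ))
  PointSet = Point → Set (c ⊔ ℓ)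

  IsLine : PointSet → Set (c ⊔ ℓ)
  IsLine M = (∀ S T → S ≈P T → M S → M T) ×
    (∀ S T → M S → M T → ¬ (S ≈P T) → Adjacent S T) ×
    (∀ T → ¬ M T → ¬ (∀ S → M S → Adjacent S T))

  Line : Set (lsuc (c ⊔ ℓ))
  Line = Σ PointSet IsLine

  Vertex : Set (lsuc (c ⊔ ℓ))
  Vertex = Point ⊎ Line

  _≈V_ : Vertex → Vertex → Set (c ⊔ ℓ)
  inj₁ S ≈V inj₁ T = Lift c (S ≈P T)
  inj₂ L ≈V inj₂ L' = ∀ S → (proj₁ L S → proj₁ L' S) × (proj₁ L' S → proj₁ L S)
  _ ≈V _ = Lift (c ⊔ ℓ) ⊥

  Edge : Vertex → Vertex → Set (c ⊔ ℓ)
  Edge (inj₁ S) (inj₂ L) = proj₁ L S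
  Edge (inj₂ L) (inj₁ S) = proj₁ L S
  Edge _ _ = Lift (c ⊔ ℓ) ⊥

  HasCycle : ℕ → Set (lsuc (c ⊔ ℓ))
  HasCycle zero = Lift _ ⊥
  HasCycle (suc m) = 3 ≤ suc m × Σ (Fin (suc m) → Vertex) λ v →
    (∀ i j → v i ≈V v j → i ≡ j) ×
    (∀ (i : Fin m) → Edge (v (inject₁ i)) (v (suc i))) ×
    Edge (v (fromℕ m)) (v zero)

  HasGirth : ℕ → Set (lsuc (c ⊔ ℓ))
  HasGirth g = HasCycle g × (∀ k → k < g → ¬ HasCycle k)

-- Two symmetric matrices are adjacent when their difference has rank one, and over a field
-- rank ≤ 1 means that all 2×2 minors vanish. The key algebraic fact is a pencil lemma: if A, B
-- and B - A are symmetric of rank ≤ 1 and A ≠ 0, then B is a multiple of A. Consequently a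
-- point adjacent to two points of a line lies on that line, so two lines sharing two points
-- coincide (no 4-cycles) and three points pairwise joined by lines lie on one line (no
-- 6-cycles); odd cycles are impossible since the graph is bipartite. An 8-cycle is given by
-- the square with corners 0, E_a, E_a + E_b, E_b, whose sides lie on lines {S + t E_k}.
module Submission where

open import Level using (_⊔_; lift)
open import Algebra.Bundles using (CommutativeRing)
open import Algebra.Solver.Ring.AlmostCommutativeRing
  using (fromCommutativeRing; _-Raw-AlmostCommutative⟶_)
import Algebra.Solver.Ring
open import Data.Bool using (Bool; true; false; not)
open import Data.Bool.Properties using (not-¬)
open import Data.Empty using (⊥; ⊥-elim)
open import Data.Fin as Fin using (Fin; zero; suc)
open import Data.Fin.Patterns using (0F; 1F; 2F; 3F; 4F; 5F; 6F; 7F)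
open import Data.Fin.Properties using (all?; ¬∀⟶∃¬)
open import Data.Integer as ℤ using (ℤ; +_; -[1+_]; _⊖_; sign; ∣_∣)
import Data.Integer.Properties as ℤ
open import Data.Maybe using (Maybe; just; nothing)
open import Data.Nat as ℕ using (ℕ; _≤_; s≤s; z≤n)
open import Data.Nat.Properties using (+-suc)
open import Data.Product using (Σ; ∃; _×_; _,_; proj₁; proj₂; swap)
open import Data.Sign as Sign using (Sign)
open import Data.Sum using (_⊎_; inj₁; inj₂)
open import Data.Vec.Functional using (_∷_; [])
open import Data.Vec.Functional.Relation.Binary.Pointwise using (Pointwise)
open import Function using (_∘_; _on_)
open import Relation.Binary.Core using (Rel)
open import Relation.Binary.Definitions using (Decidable; Reflexive; _Respects_)
open import Relation.Binary.PropositionalEquality as ≡ using (_≡_; _≢_)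
open import Relation.Nullary using (¬_; Dec; yes; no)
open import Relation.Unary using (Pred)

open import Defs

module ℤ-RingSolver {c ℓ} (R : CommutativeRing c ℓ) where
  open CommutativeRing R
  open import Algebra.Properties.Semiring.Mult semiring using (×-homo-+; ×1-homo-*) renaming (_×_ to _×ᵤ_)
  open import Algebra.Properties.Ring ring using (-‿involutive; -0#≈0#; -‿+-comm; -1*x≈-x)
  open import Algebra.Properties.CommutativeSemigroup +-commutativeSemigroup
    using () renaming (interchange to +-interchange)
  open import Algebra.Properties.CommutativeSemigroup *-commutativeSemigroup
    using () renaming (interchange to *-interchange)
  open import Relation.Binary.Reasoning.Setoid setoid

  ⟦_⟧ℤ : ℤ → Carrier
  ⟦ + n ⟧ℤ = n ×ᵤ 1#
  ⟦ -[1+ n ] ⟧ℤ = - (ℕ.suc n ×ᵤ 1#)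

  ⊖-homo : ∀ m n → ⟦ m ⊖ n ⟧ℤ ≈ m ×ᵤ 1# - n ×ᵤ 1#
  ⊖-homo m ℕ.zero = begin
    ⟦ m ⊖ 0 ⟧ℤ  ≡⟨ ≡.cong ⟦_⟧ℤ (ℤ.⊖-≥ {m} {0} z≤n) ⟩
    m ×ᵤ 1#      ≈⟨ +-identityʳ _ ⟨
    m ×ᵤ 1# + 0# ≈⟨ +-congˡ -0#≈0# ⟨
    m ×ᵤ 1# - 0# ∎
  ⊖-homo ℕ.zero (ℕ.suc n) = sym (+-identityˡ _)
  ⊖-homo (ℕ.suc m) (ℕ.suc n) = begin
    ⟦ ℕ.suc m ⊖ ℕ.suc n ⟧ℤ          ≡⟨ ≡.cong ⟦_⟧ℤ (ℤ.[1+m]⊖[1+n]≡m⊖n m n) ⟩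
    ⟦ m ⊖ n ⟧ℤ                      ≈⟨ ⊖-homo m n ⟩
    m ×ᵤ 1# - n ×ᵤ 1#                 ≈⟨ +-identityˡ _ ⟨
    0# + (m ×ᵤ 1# - n ×ᵤ 1#)          ≈⟨ +-congʳ (-‿inverseʳ 1#) ⟨
    (1# - 1#) + (m ×ᵤ 1# - n ×ᵤ 1#)   ≈⟨ +-interchange 1# (- 1#) (m ×ᵤ 1#) (- (n ×ᵤ 1#)) ⟩
    (1# + m ×ᵤ 1#) + (- 1# - n ×ᵤ 1#) ≈⟨ +-congˡ (-‿+-comm 1# (n ×ᵤ 1#)) ⟩
    (1# + m ×ᵤ 1#) - (1# + n ×ᵤ 1#)   ∎

  +-homo : ∀ i j → ⟦ i ℤ.+ j ⟧ℤ ≈ ⟦ i ⟧ℤ + ⟦ j ⟧ℤ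
  +-homo (+ m) (+ n) = ×-homo-+ 1# m n
  +-homo (+ m) -[1+ n ] = ⊖-homo m (ℕ.suc n)
  +-homo -[1+ m ] (+ n) = trans (⊖-homo n (ℕ.suc m)) (+-comm _ _)
  +-homo -[1+ m ] -[1+ n ] = begin
    - (ℕ.suc (ℕ.suc (m ℕ.+ n)) ×ᵤ 1#)   ≡⟨ ≡.cong (λ k → - (ℕ.suc k ×ᵤ 1#)) (+-suc m n) ⟨
    - ((ℕ.suc m ℕ.+ ℕ.suc n) ×ᵤ 1#)     ≈⟨ -‿cong (×-homo-+ 1# (ℕ.suc m) (ℕ.suc n)) ⟩
    - (ℕ.suc m ×ᵤ 1# + ℕ.suc n ×ᵤ 1#)    ≈⟨ -‿+-comm _ _ ⟨
    - (ℕ.suc m ×ᵤ 1#) - ℕ.suc n ×ᵤ 1#    ∎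

  -‿homo : ∀ i → ⟦ ℤ.- i ⟧ℤ ≈ - ⟦ i ⟧ℤ
  -‿homo (+ ℕ.zero) = sym -0#≈0#
  -‿homo (+ ℕ.suc n) = refl
  -‿homo -[1+ n ] = sym (-‿involutive _)

  sign⟦_⟧ : Sign → Carrier
  sign⟦ Sign.+ ⟧ = 1#
  sign⟦ Sign.- ⟧ = - 1#

  sign-homo : ∀ s t → sign⟦ s Sign.* t ⟧ ≈ sign⟦ s ⟧ * sign⟦ t ⟧
  sign-homo Sign.+ t = sym (*-identityˡ _)
  sign-homo Sign.- Sign.+ = sym (*-identityʳ _)
  sign-homo Sign.- Sign.- = sym (trans (-1*x≈-x (- 1#)) (-‿involutive 1#))

  ◃-homo : ∀ s n → ⟦ s ℤ.◃ n ⟧ℤ ≈ sign⟦ s ⟧ * (n ×ᵤ 1#)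
  ◃-homo s ℕ.zero = sym (zeroʳ _)
  ◃-homo Sign.+ (ℕ.suc n) = sym (*-identityˡ _)
  ◃-homo Sign.- (ℕ.suc n) = sym (-1*x≈-x _)

  ⟦⟧-sign-abs : ∀ i → ⟦ i ⟧ℤ ≈ sign⟦ sign i ⟧ * (∣ i ∣ ×ᵤ 1#)
  ⟦⟧-sign-abs i = begin
    ⟦ i ⟧ℤ                            ≡⟨ ≡.cong ⟦_⟧ℤ (ℤ.◃-inverse i) ⟨
    ⟦ sign i ℤ.◃ ∣ i ∣ ⟧ℤ         ≈⟨ ◃-homo (sign i) ∣ i ∣ ⟩
    sign⟦ sign i ⟧ * (∣ i ∣ ×ᵤ 1#) ∎

  *-homo : ∀ i j → ⟦ i ℤ.* j ⟧ℤ ≈ ⟦ i ⟧ℤ * ⟦ j ⟧ℤ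
  *-homo i j = begin
    ⟦ i ℤ.* j ⟧ℤ
      ≈⟨ ◃-homo (sign i Sign.* sign j) (∣ i ∣ ℕ.* ∣ j ∣) ⟩
    sign⟦ sign i Sign.* sign j ⟧ * ((∣ i ∣ ℕ.* ∣ j ∣) ×ᵤ 1#)
      ≈⟨ *-cong (sign-homo (sign i) (sign j)) (×1-homo-* ∣ i ∣ ∣ j ∣) ⟩
    (sign⟦ sign i ⟧ * sign⟦ sign j ⟧) * ((∣ i ∣ ×ᵤ 1#) * (∣ j ∣ ×ᵤ 1#))
      ≈⟨ *-interchange _ _ _ _ ⟩
    (sign⟦ sign i ⟧ * (∣ i ∣ ×ᵤ 1#)) * (sign⟦ sign j ⟧ * (∣ j ∣ ×ᵤ 1#))
      ≈⟨ *-cong (⟦⟧-sign-abs i) (⟦⟧-sign-abs j) ⟨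
    ⟦ i ⟧ℤ * ⟦ j ⟧ℤ ∎

  ℤ⟶R : ℤ.+-*-rawRing -Raw-AlmostCommutative⟶ fromCommutativeRing R
  ℤ⟶R = record
    { ⟦_⟧ = ⟦_⟧ℤ ; +-homo = +-homo ; *-homo = *-homo ; -‿homo = -‿homo
    ; 0-homo = refl ; 1-homo = +-identityʳ 1# }

  ⟦⟧-≟ : ∀ i j → Maybe (⟦ i ⟧ℤ ≈ ⟦ j ⟧ℤ)
  ⟦⟧-≟ i j with i ℤ.≟ j
  ... | yes ≡.refl = just refl
  ... | no _ = nothing

  open Algebra.Solver.Ring ℤ.+-*-rawRing (fromCommutativeRing R) ℤ⟶R ⟦⟧-≟ public

DoubleNegationShift : ∀ {a r} p {A : Set a} → Rel A r → Set (a ⊔ r ⊔ Level.suc p)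
DoubleNegationShift p {A} _∼_ =
  (P : Pred A p) → P Respects _∼_ → (∀ x → ¬ ¬ P x) → ¬ ¬ (∀ x → P x)

¬¬-shift-Fin : ∀ {p} k (P : Pred (Fin k) p) → (∀ i → ¬ ¬ P i) → ¬ ¬ (∀ i → P i)
¬¬-shift-Fin ℕ.zero P _ ¬∀P = ¬∀P λ ()
¬¬-shift-Fin (ℕ.suc k) P ¬¬P ¬∀P = ¬¬P zero λ P0 →
  ¬¬-shift-Fin k (P ∘ suc) (¬¬P ∘ suc) λ P∘suc → ¬∀P λ { zero → P0 ; (suc i) → P∘suc i }

module _ {a r} {A : Set a} {_∼_ : Rel A r} where

  ¬¬-shift-surjection : ∀ {p k} (e : Fin k → A) → (∀ x → ∃ λ i → e i ∼ x) →
                        DoubleNegationShift p _∼_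
  ¬¬-shift-surjection e surjective P resp ¬¬P ¬∀P =
    ¬¬-shift-Fin _ (P ∘ e) (¬¬P ∘ e) λ P∘e →
      ¬∀P λ x → resp (proj₂ (surjective x)) (P∘e (proj₁ (surjective x)))

  ¬¬-shift-Π : ∀ {p} → Reflexive _∼_ → DoubleNegationShift (a ⊔ p) _∼_ →
               ∀ k → DoubleNegationShift (a ⊔ p) (Pointwise _∼_ {k})
  ¬¬-shift-Π ∼-refl shift ℕ.zero P resp ¬¬P ¬∀P =
    ¬¬P [] λ P[] → ¬∀P λ f → resp (λ ()) P[]
  ¬¬-shift-Π {p} ∼-refl shift (ℕ.suc k) P resp ¬¬P ¬∀P =
    shift Q resp-Q ¬¬Q λ ∀Q → ¬∀P λ f → resp (λ { zero → ∼-refl ; (suc i) → ∼-refl })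
                                                (∀Q (f zero) (f ∘ suc))
    where
    Q : Pred A (a ⊔ p)
    Q x = ∀ g → P (x ∷ g)
    resp-Q : Q Respects _∼_
    resp-Q x∼y Qx g = resp (λ { zero → x∼y ; (suc i) → ∼-refl }) (Qx g)
    ¬¬Q : ∀ x → ¬ ¬ Q x
    ¬¬Q x = ¬¬-shift-Π {p} ∼-refl shift k (P ∘ (x ∷_))
      (λ g∼h → resp λ { zero → ∼-refl ; (suc i) → g∼h i }) (¬¬P ∘ (x ∷_))

  ¬¬-shift-Σ : ∀ {b p} {B : A → Set b} → Reflexive _∼_ → (∀ {x y} → x ∼ y → B y → B x) →
               DoubleNegationShift (b ⊔ p) _∼_ → DoubleNegationShift p {Σ A B} (_∼_ on proj₁)
  ¬¬-shift-Σ {B = B} ∼-refl transport shift P resp ¬¬P ¬∀P =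
    shift Q resp-Q ¬¬Q λ ∀Q → ¬∀P λ (x , s) → ∀Q x s
    where
    Q : Pred A _
    Q x = (s : B x) → P (x , s)
    resp-Q : Q Respects _∼_
    resp-Q x∼y Qx s = resp x∼y (Qx (transport x∼y s))
    ¬¬Q : ∀ x → ¬ ¬ Q x
    ¬¬Q x ¬Qx = ¬Qx λ s → ⊥-elim (¬¬P (x , s) λ Pxs → ¬Qx λ s′ → resp ∼-refl Pxs)

module _ {c ℓ} (F : CommutativeRing c ℓ) where
  open CommutativeRing F

  finite⇒decidable : ∀ {q} → HasCardinality F q → Decidable _≈_
  finite⇒decidable (e , e-injective , e-surjective) x y
    with e-surjective x | e-surjective y
  ... | i , eᵢ≈x | j , eⱼ≈y with i Fin.≟ j
  ...   | yes ≡.refl = yes (trans (sym eᵢ≈x) eⱼ≈y)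
  ...   | no i≢j = no λ x≈y → i≢j (e-injective i j (trans eᵢ≈x (trans x≈y (sym eⱼ≈y))))

module DiscreteField {c ℓ} (F : CommutativeRing c ℓ) (isField : IsField F)
                     (_≟_ : Decidable (CommutativeRing._≈_ F)) where
  open CommutativeRing F hiding (zero)
  open IsField isField
  open ℤ-RingSolver F using (solve; _:=_; _:+_; _:*_; _:-_; :-_; con)
  open import Algebra.Properties.Group +-group
    using (x∙y⁻¹≈ε⇒x≈y; x≈y⇒x∙y⁻¹≈ε; ∙-cancelʳ; ⁻¹-anti-homo-//)
  open import Algebra.Properties.Ring ring
    using (-‿involutive; -0#≈0#; [y-z]x≈yx-zx; x[y-z]≈xy-xz; -1*x≈-x)
  open import Algebra.Properties.CommutativeSemigroup *-commutativeSemigroup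
    using () renaming (interchange to *-interchange)
  open import Relation.Binary.Reasoning.Setoid setoid

  x-y≈0⇒x≈y : ∀ {x y} → x - y ≈ 0# → x ≈ y
  x-y≈0⇒x≈y = x∙y⁻¹≈ε⇒x≈y _ _

  x≈y⇒x-y≈0 : ∀ {x y} → x ≈ y → x - y ≈ 0#
  x≈y⇒x-y≈0 = x≈y⇒x∙y⁻¹≈ε

  -x≈0⇒x≈0 : ∀ {x} → - x ≈ 0# → x ≈ 0#
  -x≈0⇒x≈0 {x} -x≈0 = trans (sym (-‿involutive x)) (trans (-‿cong -x≈0) -0#≈0#)

  1≉0 : 1# ≉ 0#
  1≉0 = 0≉1 ∘ sym

  x*y≈0⇒x≈0 : ∀ {x y} → y ≉ 0# → x * y ≈ 0# → x ≈ 0#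
  x*y≈0⇒x≈0 {x} {y} y≉0 xy≈0 with inverse y y≉0
  ... | y⁻¹ , yy⁻¹≈1 = begin
    x              ≈⟨ *-identityʳ x ⟨
    x * 1#         ≈⟨ *-congˡ yy⁻¹≈1 ⟨
    x * (y * y⁻¹)  ≈⟨ *-assoc x y y⁻¹ ⟨
    (x * y) * y⁻¹  ≈⟨ *-congʳ xy≈0 ⟩
    0# * y⁻¹       ≈⟨ zeroˡ y⁻¹ ⟩
    0#             ∎

  x≉0∧y≉0⇒x*y≉0 : ∀ {x y} → x ≉ 0# → y ≉ 0# → x * y ≉ 0#
  x≉0∧y≉0⇒x*y≉0 x≉0 y≉0 = x≉0 ∘ x*y≈0⇒x≈0 y≉0

  x*x≈0⇒x≈0 : ∀ {x} → x * x ≈ 0# → x ≈ 0#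
  x*x≈0⇒x≈0 {x} xx≈0 with x ≟ 0#
  ... | yes x≈0 = x≈0
  ... | no x≉0 = ⊥-elim (x≉0∧y≉0⇒x*y≉0 x≉0 x≉0 xx≈0)

  *-cancelˡ-≉0 : ∀ {a x y} → a ≉ 0# → a * x ≈ a * y → x ≈ y
  *-cancelˡ-≉0 {a} {x} {y} a≉0 ax≈ay = x-y≈0⇒x≈y (x*y≈0⇒x≈0 a≉0 (begin
    (x - y) * a    ≈⟨ [y-z]x≈yx-zx a x y ⟩
    x * a - y * a  ≈⟨ +-cong (*-comm x a) (-‿cong (*-comm y a)) ⟩
    a * x - a * y  ≈⟨ x≈y⇒x-y≈0 ax≈ay ⟩
    0#             ∎))

  det≉0⇒trivial-kernel : ∀ {p q r s a b} → p * s ≉ r * q →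
    a * p + b * q ≈ 0# → a * r + b * s ≈ 0# → a ≈ 0# × b ≈ 0#
  det≉0⇒trivial-kernel {p} {q} {r} {s} {a} {b} det≉0 eq₁ eq₂ =
    x*y≈0⇒x≈0 Δ≉0 (begin
      a * (p * s - r * q)
        ≈⟨ solve 6 (λ p q r s a b → a :* (p :* s :- r :* q)
                                  := s :* (a :* p :+ b :* q) :- q :* (a :* r :+ b :* s)) refl p q r s a b ⟩
      s * (a * p + b * q) - q * (a * r + b * s)
        ≈⟨ zero-combination s q eq₁ eq₂ ⟩
      0# ∎) ,
    x*y≈0⇒x≈0 Δ≉0 (begin
      b * (p * s - r * q)
        ≈⟨ solve 6 (λ p q r s a b → b :* (p :* s :- r :* q)
                                  := p :* (a :* r :+ b :* s) :- r :* (a :* p :+ b :* q)) refl p q r s a b ⟩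
      p * (a * r + b * s) - r * (a * p + b * q)
        ≈⟨ zero-combination p r eq₂ eq₁ ⟩
      0# ∎)
    where
    Δ≉0 : p * s - r * q ≉ 0#
    Δ≉0 = det≉0 ∘ x-y≈0⇒x≈y
    zero-combination : ∀ {u v} x y → u ≈ 0# → v ≈ 0# → x * u - y * v ≈ 0#
    zero-combination x y u≈0 v≈0 =
      x≈y⇒x-y≈0 (trans (trans (*-congˡ u≈0) (zeroʳ x)) (sym (trans (*-congˡ v≈0) (zeroʳ y))))

  *-shift⁺ : ∀ {α β x y} → α * x ≈ β * y → α * (x - y) ≈ (β - α) * y
  *-shift⁺ {α} {β} {x} {y} αx≈βy =
    trans (x[y-z]≈xy-xz α x y) (trans (+-congʳ αx≈βy) (sym ([y-z]x≈yx-zx y β α)))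

  *-shift⁻ : ∀ {α β x y} → α * (x - y) ≈ (β - α) * y → α * x ≈ β * y
  *-shift⁻ {α} {β} {x} {y} eq =
    ∙-cancelʳ (- (α * y)) _ _ (trans (sym (x[y-z]≈xy-xz α x y)) (trans eq ([y-z]x≈yx-zx y β α)))

  module Geometry (n : ℕ) where
    open Sym F n

    _-ᴹ_ : Mat → Mat → Mat
    (M -ᴹ N) i j = M i j - N i j

    IsSymmetric : Mat → Set ℓ
    IsSymmetric M = ∀ i j → M i j ≈ M j i

    -- Over a field, rank M ≤ 1 iff all 2×2 minors of M vanish.
    Rank≤1 : Mat → Set ℓ
    Rank≤1 M = ∀ i j k l → M i j * M k l ≈ M i l * M k j

    HasNonzeroEntry : Mat → Set ℓ
    HasNonzeroEntry M = ∃ λ i → ∃ λ j → M i j ≉ 0#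

    zero-or-nonzero : ∀ {k} (v : Fin k → Carrier) → (∀ j → v j ≈ 0#) ⊎ ∃ λ j → v j ≉ 0#
    zero-or-nonzero v with all? (λ j → v j ≟ 0#)
    ... | yes v≈0 = inj₁ v≈0
    ... | no v≉0 = inj₂ (¬∀⟶∃¬ _ _ (λ j → v j ≟ 0#) v≉0)

    ∑-two : ∀ f → ∑ F 2 f ≈ f zero + f (suc zero)
    ∑-two f = +-congˡ (+-identityʳ _)

    hasRank1⇒rank≤1 : ∀ {M} → HasRank M 1 → Rank≤1 M
    hasRank1⇒rank≤1 {M} (_ , no-independent-pair) i j k l with (M i j * M k l) ≟ (M i l * M k j)
    ... | yes minor≈0 = minor≈0
    ... | no minor≉0 with i Fin.≟ k
    ...   | yes ≡.refl = ⊥-elim (minor≉0 (*-comm _ _))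
    ...   | no i≢k = ⊥-elim (no-independent-pair (i ∷ k ∷ []) (injective , independent))
      where
      injective : ∀ s t → (i ∷ k ∷ []) s ≡ (i ∷ k ∷ []) t → s ≡ t
      injective zero zero _ = ≡.refl
      injective zero (suc zero) i≡k = ⊥-elim (i≢k i≡k)
      injective (suc zero) zero k≡i = ⊥-elim (i≢k (≡.sym k≡i))
      injective (suc zero) (suc zero) _ = ≡.refl
      independent : ∀ a → (∀ j → ∑ F 2 (λ t → a t * M ((i ∷ k ∷ []) t) j) ≈ 0#) → ∀ t → a t ≈ 0#
      independent a combination≈0 = select (det≉0⇒trivial-kernel minor≉0 (column j) (column l))
        where
        column : ∀ j → a zero * M i j + a (suc zero) * M k j ≈ 0#
        column j = trans (sym (∑-two λ t → a t * M ((i ∷ k ∷ []) t) j)) (combination≈0 j)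
        select : a zero ≈ 0# × a (suc zero) ≈ 0# → ∀ t → a t ≈ 0#
        select (a₀≈0 , _) zero = a₀≈0
        select (_ , a₁≈0) (suc zero) = a₁≈0

    rank≤1⇒hasRank1 : ∀ {M} → Rank≤1 M → HasNonzeroEntry M → HasRank M 1
    rank≤1⇒hasRank1 {M} rank≤1 (r , j₀ , Mrj₀≉0) =
      ((λ _ → r) , (λ { zero zero _ → ≡.refl }) , row-independent) , no-independent-pair
      where
      row-independent : ∀ a → (∀ j → ∑ F 1 (λ t → a t * M r j) ≈ 0#) → ∀ t → a t ≈ 0#
      row-independent a combination≈0 zero =
        x*y≈0⇒x≈0 Mrj₀≉0 (trans (sym (+-identityʳ _)) (combination≈0 j₀))
      no-independent-pair : ∀ ι → ¬ IndependentRows M 2 ι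
      no-independent-pair ι (_ , independent) with zero-or-nonzero (M (ι zero))
      ... | inj₁ row₀≈0 = 1≉0 (independent (1# ∷ 0# ∷ []) trivial zero)
        where
        trivial : ∀ j → ∑ F 2 (λ t → (1# ∷ 0# ∷ []) t * M (ι t) j) ≈ 0#
        trivial j = trans (∑-two λ t → (1# ∷ 0# ∷ []) t * M (ι t) j)
          (trans (+-cong (trans (*-identityˡ _) (row₀≈0 j)) (zeroˡ _)) (+-identityʳ 0#))
      ... | inj₂ (j₁ , M₀j₁≉0) = M₀j₁≉0 (-x≈0⇒x≈0 (independent a nontrivial (suc zero)))
        where
        a : Fin 2 → Carrier
        a = M (ι (suc zero)) j₁ ∷ - M (ι zero) j₁ ∷ []
        nontrivial : ∀ j → ∑ F 2 (λ t → a t * M (ι t) j) ≈ 0#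
        nontrivial j = begin
          ∑ F 2 (λ t → a t * M (ι t) j)
            ≈⟨ ∑-two (λ t → a t * M (ι t) j) ⟩
          M₁j₁ * M₀j + - M₀j₁ * M₁j
            ≈⟨ solve 4 (λ x y w v → y :* x :+ :- w :* v := x :* y :- w :* v) refl M₀j M₁j₁ M₀j₁ M₁j ⟩
          M₀j * M₁j₁ - M₀j₁ * M₁j
            ≈⟨ x≈y⇒x-y≈0 (rank≤1 (ι zero) j (ι (suc zero)) j₁) ⟩
          0# ∎
          where
          M₀j = M (ι zero) j
          M₁j = M (ι (suc zero)) j
          M₀j₁ = M (ι zero) j₁
          M₁j₁ = M (ι (suc zero)) j₁

    rank≤1-scale : ∀ {M N s t} → s ≉ 0# → (∀ i j → s * M i j ≈ t * N i j) → Rank≤1 N → Rank≤1 M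
    rank≤1-scale {M} {N} {s} {t} s≉0 sM≈tN rank≤1 i j k l =
      *-cancelˡ-≉0 (x≉0∧y≉0⇒x*y≉0 s≉0 s≉0) (begin
        (s * s) * (M i j * M k l) ≈⟨ *-interchange s s _ _ ⟩
        (s * M i j) * (s * M k l) ≈⟨ *-cong (sM≈tN i j) (sM≈tN k l) ⟩
        (t * N i j) * (t * N k l) ≈⟨ *-interchange t _ t _ ⟩
        (t * t) * (N i j * N k l) ≈⟨ *-congˡ (rank≤1 i j k l) ⟩
        (t * t) * (N i l * N k j) ≈⟨ *-interchange t t _ _ ⟩
        (t * N i l) * (t * N k j) ≈⟨ *-cong (sM≈tN i l) (sM≈tN k j) ⟨
        (s * M i l) * (s * M k j) ≈⟨ *-interchange s _ s _ ⟩
        (s * s) * (M i l * M k j) ∎)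

    rank≤1-resp : ∀ {M N} → (∀ i j → M i j ≈ N i j) → Rank≤1 N → Rank≤1 M
    rank≤1-resp M≈N = rank≤1-scale 1≉0 (λ i j → *-congˡ (M≈N i j))

    rank≤1-zero : ∀ {M} → (∀ i j → M i j ≈ 0#) → Rank≤1 M
    rank≤1-zero {M} M≈0 i j k l =
      trans (trans (*-congʳ (M≈0 i j)) (zeroˡ _)) (sym (trans (*-congʳ (M≈0 i l)) (zeroˡ _)))

    outer-rank≤1 : ∀ (u : Fin n → Carrier) → Rank≤1 (λ i j → u i * u j)
    outer-rank≤1 u i j k l = begin
      (u i * u j) * (u k * u l) ≈⟨ *-interchange _ _ _ _ ⟩
      (u i * u k) * (u j * u l) ≈⟨ *-congˡ (*-comm _ _) ⟩
      (u i * u k) * (u l * u j) ≈⟨ *-interchange _ _ _ _ ⟩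
      (u i * u l) * (u k * u j) ∎

    module _ {A : Mat} (A-sym : IsSymmetric A) (A-rank≤1 : Rank≤1 A) where

      sym-rank≤1-entry : ∀ p i j → A p p * A i j ≈ A p i * A p j
      sym-rank≤1-entry p i j = begin
        A p p * A i j ≈⟨ A-rank≤1 p p i j ⟩
        A p j * A i p ≈⟨ *-comm _ _ ⟩
        A i p * A p j ≈⟨ *-congʳ (A-sym i p) ⟩
        A p i * A p j ∎

      sym-rank≤1-diagonal : ∀ {i j} → A i j ≉ 0# → A i i ≉ 0#
      sym-rank≤1-diagonal {i} {j} Aij≉0 Aii≈0 = Aij≉0 (x*x≈0⇒x≈0 (begin
        A i j * A i j ≈⟨ *-congˡ (A-sym i j) ⟩
        A i j * A j i ≈⟨ A-rank≤1 i j j i ⟩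
        A i i * A j j ≈⟨ *-congʳ Aii≈0 ⟩
        0# * A j j    ≈⟨ zeroˡ _ ⟩
        0#            ∎))

    proportional-rows⇒proportional : ∀ {A B} → IsSymmetric A → IsSymmetric B → Rank≤1 A → Rank≤1 B →
      ∀ {p} → A p p ≉ 0# → B p p ≉ 0# → (∀ i → A p p * B p i ≈ B p p * A p i) →
      ∀ i j → A p p * B i j ≈ B p p * A i j
    proportional-rows⇒proportional {A} {B} A-sym B-sym A-rank≤1 B-rank≤1 {p} α≉0 β≉0 rows i j =
      *-cancelˡ-≉0 (x≉0∧y≉0⇒x*y≉0 α≉0 β≉0) (begin
        (α * β) * (α * B i j)     ≈⟨ *-interchange α β α (B i j) ⟩
        (α * α) * (β * B i j)     ≈⟨ *-congˡ (sym-rank≤1-entry B-sym B-rank≤1 p i j) ⟩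
        (α * α) * (B p i * B p j) ≈⟨ *-interchange α α _ _ ⟩
        (α * B p i) * (α * B p j) ≈⟨ *-cong (rows i) (rows j) ⟩
        (β * A p i) * (β * A p j) ≈⟨ *-interchange β _ β _ ⟩
        (β * β) * (A p i * A p j) ≈⟨ *-congˡ (sym-rank≤1-entry A-sym A-rank≤1 p i j) ⟨
        (β * β) * (α * A i j)     ≈⟨ *-interchange β β α _ ⟩
        (β * α) * (β * A i j)     ≈⟨ *-congʳ (*-comm β α) ⟩
        (α * β) * (β * A i j)     ∎)
      where
      α = A p p
      β = B p p

    module _ {A B : Mat} (A-sym : IsSymmetric A) (B-sym : IsSymmetric B)
             (A-rank≤1 : Rank≤1 A) (B-rank≤1 : Rank≤1 B) (B-A-rank≤1 : Rank≤1 (B -ᴹ A)) where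

      private
        B-A-sym : IsSymmetric (B -ᴹ A)
        B-A-sym i j = +-cong (B-sym i j) (-‿cong (A-sym i j))

      -- The three relations α A_ii = u², β B_ii = w², (β - α)(B_ii - A_ii) = (w - u)²
      -- combine to (α w - β u)² = 0.
      rank≤1-pencil-row : ∀ p i → A p p * B p i ≈ B p p * A p i
      rank≤1-pencil-row p i = x-y≈0⇒x≈y (x*x≈0⇒x≈0 (-x≈0⇒x≈0 (begin
        - ((α * w - β * u) * (α * w - β * u))
          ≈⟨ solve 4 (λ α β w u → :- ((α :* w :- β :* u) :* (α :* w :- β :* u))
                := (β :- α) :* α :* (w :* w) :- (β :- α) :* β :* (u :* u) :- α :* β :* ((w :- u) :* (w :- u)))
               refl α β w u ⟩
        (β - α) * α * (w * w) - (β - α) * β * (u * u) - α * β * ((w - u) * (w - u))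
          ≈⟨ +-cong (+-cong (*-congˡ B-entry) (-‿cong (*-congˡ A-entry))) (-‿cong (*-congˡ B-A-entry)) ⟨
        (β - α) * α * (β * B i i) - (β - α) * β * (α * A i i) - α * β * ((β - α) * (B i i - A i i))
          ≈⟨ solve 4 (λ α β A B → (β :- α) :* α :* (β :* B) :- (β :- α) :* β :* (α :* A)
                                     :- α :* β :* ((β :- α) :* (B :- A)) := con (+ 0))
               refl α β (A i i) (B i i) ⟩
        0# ∎)))
        where
        α = A p p
        β = B p p
        u = A p i
        w = B p i
        A-entry = sym-rank≤1-entry A-sym A-rank≤1 p i i
        B-entry = sym-rank≤1-entry B-sym B-rank≤1 p i i
        B-A-entry = sym-rank≤1-entry B-A-sym B-A-rank≤1 p i i

      -- Pivot on B when B p p ≉ 0, otherwise on B - A, whose (p, p) entry is then - A p p.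
      rank≤1-pencil : ∀ {p} → A p p ≉ 0# → ∀ i j → A p p * B i j ≈ B p p * A i j
      rank≤1-pencil {p} α≉0 with B p p ≟ 0#
      ... | no β≉0 = proportional-rows⇒proportional A-sym B-sym A-rank≤1 B-rank≤1 α≉0 β≉0
                       (rank≤1-pencil-row p)
      ... | yes β≈0 = λ i j → *-shift⁻ (proportional-rows⇒proportional A-sym B-A-sym A-rank≤1 B-A-rank≤1
                       α≉0 β-α≉0 (λ i → *-shift⁺ (rank≤1-pencil-row p i)) i j)
        where
        β-α≉0 : B p p - A p p ≉ 0#
        β-α≉0 β-α≈0 = α≉0 (trans (sym (x-y≈0⇒x≈y β-α≈0)) β≈0)

    _⊟_ : Point → Point → Mat
    S ⊟ T = proj₁ S -ᴹ proj₁ T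

    -- S and T are equal or adjacent.
    Near : Point → Point → Set ℓ
    Near S T = Rank≤1 (S ⊟ T)

    ⊟-sym : ∀ S T → IsSymmetric (S ⊟ T)
    ⊟-sym (_ , S-sym) (_ , T-sym) i j = +-cong (S-sym i j) (-‿cong (T-sym i j))

    ≈P? : ∀ S T → Dec (S ≈P T)
    ≈P? S T = all? λ i → all? λ j → proj₁ S i j ≟ proj₁ T i j

    ≉P⇒nonzero : ∀ {S T} → ¬ S ≈P T → HasNonzeroEntry (S ⊟ T)
    ≉P⇒nonzero {S} {T} S≉T with ¬∀⟶∃¬ n _ (λ i → all? λ j → proj₁ S i j ≟ proj₁ T i j) S≉T
    ... | i , row-i≉ with ¬∀⟶∃¬ n _ (λ j → proj₁ S i j ≟ proj₁ T i j) row-i≉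
    ...   | j , Sij≉Tij = i , j , Sij≉Tij ∘ x-y≈0⇒x≈y

    ≈P⇒near : ∀ {S T} → S ≈P T → Near S T
    ≈P⇒near S≈T = rank≤1-zero λ i j → x≈y⇒x-y≈0 (S≈T i j)

    adjacent⇒near : ∀ {S T} → Adjacent S T → Near S T
    adjacent⇒near = hasRank1⇒rank≤1

    near⇒adjacent : ∀ {S T} → Near S T → ¬ S ≈P T → Adjacent S T
    near⇒adjacent {S} {T} S~T S≉T = rank≤1⇒hasRank1 S~T (≉P⇒nonzero {S} {T} S≉T)

    near-sym : ∀ {S T} → Near S T → Near T S
    near-sym {S} {T} = rank≤1-scale 1≉0 λ i j → begin
      1# * (T ⊟ S) i j     ≈⟨ *-identityˡ _ ⟩
      (T ⊟ S) i j          ≈⟨ ⁻¹-anti-homo-// _ _ ⟨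
      - (S ⊟ T) i j        ≈⟨ -1*x≈-x _ ⟨
      - 1# * (S ⊟ T) i j   ∎

    -- If P ≠ Q are adjacent, then X - P and Y - P are multiples of Q - P by the pencil lemma,
    -- hence so is X - Y.
    near-of-near-pair : ∀ {P Q X Y} → ¬ Q ≈P P → Near Q P →
      Near X P → Near X Q → Near Y P → Near Y Q → Near X Y
    near-of-near-pair {P} {Q} {X} {Y} Q≉P Q~P X~P X~Q Y~P Y~Q
      with ≉P⇒nonzero {Q} {P} Q≉P
    ... | i₀ , j₀ , A≉0 = rank≤1-scale α≉0 X-Y∼A Q~P
      where
      A = Q ⊟ P
      α≉0 : A i₀ i₀ ≉ 0#
      α≉0 = sym-rank≤1-diagonal (⊟-sym Q P) Q~P A≉0
      multiple-of-A : ∀ {R} → Near R P → Near R Q → ∀ i j → A i₀ i₀ * (R ⊟ P) i j ≈ (R ⊟ P) i₀ i₀ * A i j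
      multiple-of-A {R} R~P R~Q = rank≤1-pencil (⊟-sym Q P) (⊟-sym R P) Q~P R~P
        (rank≤1-resp (λ i j → solve 3 (λ r p q → (r :- p) :- (q :- p) := r :- q) refl
                                 (proj₁ R i j) (proj₁ P i j) (proj₁ Q i j)) R~Q) α≉0
      X-Y∼A : ∀ i j → A i₀ i₀ * (X ⊟ Y) i j ≈ ((X ⊟ P) i₀ i₀ - (Y ⊟ P) i₀ i₀) * A i j
      X-Y∼A i j = begin
        A i₀ i₀ * (X ⊟ Y) i j
          ≈⟨ solve 4 (λ α x y p → α :* (x :- y) := α :* (x :- p) :- α :* (y :- p)) refl
               (A i₀ i₀) (proj₁ X i j) (proj₁ Y i j) (proj₁ P i j) ⟩
        A i₀ i₀ * (X ⊟ P) i j - A i₀ i₀ * (Y ⊟ P) i j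
          ≈⟨ +-cong (multiple-of-A {X} X~P X~Q i j) (-‿cong (multiple-of-A {Y} Y~P Y~Q i j)) ⟩
        (X ⊟ P) i₀ i₀ * A i j - (Y ⊟ P) i₀ i₀ * A i j
          ≈⟨ [y-z]x≈yx-zx (A i j) _ _ ⟨
        ((X ⊟ P) i₀ i₀ - (Y ⊟ P) i₀ i₀) * A i j ∎

    _∈_ : Point → Line → Set (c ⊔ ℓ)
    S ∈ L = proj₁ L S

    _≈L_ : Line → Line → Set (c ⊔ ℓ)
    L ≈L L′ = inj₂ L ≈V inj₂ L′

    ∈-resp : ∀ L {S T} → S ≈P T → S ∈ L → T ∈ L
    ∈-resp L = proj₁ (proj₂ L) _ _

    module _ (L : Line) where
      private
        ∈⇒adjacent : ∀ S T → S ∈ L → T ∈ L → ¬ S ≈P T → Adjacent S T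
        ∈⇒adjacent = proj₁ (proj₂ (proj₂ L))
        maximal : ∀ T → ¬ T ∈ L → ¬ (∀ S → S ∈ L → Adjacent S T)
        maximal = proj₂ (proj₂ (proj₂ L))

      line-near : ∀ {S T} → S ∈ L → T ∈ L → Near S T
      line-near {S} {T} S∈L T∈L with ≈P? S T
      ... | yes S≈T = ≈P⇒near {S} {T} S≈T
      ... | no S≉T = adjacent⇒near {S} {T} (∈⇒adjacent S T S∈L T∈L S≉T)

      line-through : ∀ {P Q R} → P ∈ L → Q ∈ L → ¬ P ≈P Q → Near R P → Near R Q → ¬ ¬ R ∈ L
      line-through {P} {Q} {R} P∈L Q∈L P≉Q R~P R~Q R∉L = maximal R R∉L λ S S∈L →
        near⇒adjacent {S} {R}
          (near-of-near-pair {P} {Q} {S} {R} (λ Q≈P → P≉Q λ i j → sym (Q≈P i j)) (line-near Q∈L P∈L)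
             (line-near S∈L P∈L) (line-near S∈L Q∈L) R~P R~Q)
          (λ S≈R → R∉L (∈-resp L S≈R S∈L))

    δ : Fin n → Fin n → Carrier
    δ k i with i Fin.≟ k
    ... | yes _ = 1#
    ... | no _ = 0#

    δ-diag : ∀ k → δ k k ≈ 1#
    δ-diag k with k Fin.≟ k
    ... | yes _ = refl
    ... | no k≢k = ⊥-elim (k≢k ≡.refl)

    δ-off : ∀ {k i} → i ≢ k → δ k i ≈ 0#
    δ-off {k} {i} i≢k with i Fin.≟ k
    ... | yes i≡k = ⊥-elim (i≢k i≡k)
    ... | no _ = refl

    E : Fin n → Mat
    E k i j = δ k i * δ k j

    E-sym : ∀ k → IsSymmetric (E k)
    E-sym k i j = *-comm _ _

    E-rank≤1 : ∀ k → Rank≤1 (E k)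
    E-rank≤1 k = outer-rank≤1 (δ k)

    E-diag : ∀ k → E k k k ≈ 1#
    E-diag k = trans (*-cong (δ-diag k) (δ-diag k)) (*-identityʳ 1#)

    E-off : ∀ {k i} → i ≢ k → E k i i ≈ 0#
    E-off i≢k = trans (*-congʳ (δ-off i≢k)) (zeroˡ _)

    OnLine : Point → Fin n → Point → Set (c ⊔ ℓ)
    OnLine S k T = ∃ λ t → ∀ i j → proj₁ T i j ≈ proj₁ S i j + t * E k i j

    on-line-diag : ∀ {S k T i} → OnLine S k T → i ≢ k → proj₁ T i i ≈ proj₁ S i i
    on-line-diag (t , T≈S+tE) i≢k =
      trans (T≈S+tE _ _) (trans (+-congˡ (trans (*-congˡ (E-off i≢k)) (zeroʳ t))) (+-identityʳ _))

    -- Maximality: a point adjacent to both S and S + E k is of the form S + t E k by the pencil lemma.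
    line : Point → Fin n → Line
    line S k = OnLine S k , resp , adjacent , maximal
      where
      resp : ∀ T T′ → T ≈P T′ → OnLine S k T → OnLine S k T′
      resp T T′ T≈T′ (t , T≈S+tE) = t , λ i j → trans (sym (T≈T′ i j)) (T≈S+tE i j)

      adjacent : ∀ T₁ T₂ → OnLine S k T₁ → OnLine S k T₂ → ¬ T₁ ≈P T₂ → Adjacent T₁ T₂
      adjacent T₁ T₂ (t₁ , T₁≈) (t₂ , T₂≈) = near⇒adjacent {T₁} {T₂} (rank≤1-scale 1≉0 (λ i j → begin
        1# * (T₁ ⊟ T₂) i j                                  ≈⟨ *-identityˡ _ ⟩
        proj₁ T₁ i j - proj₁ T₂ i j                         ≈⟨ +-cong (T₁≈ i j) (-‿cong (T₂≈ i j)) ⟩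
        (proj₁ S i j + t₁ * E k i j) - (proj₁ S i j + t₂ * E k i j)
          ≈⟨ solve 4 (λ s a b e → (s :+ a :* e) :- (s :+ b :* e) := (a :- b) :* e) refl (proj₁ S i j) t₁ t₂ (E k i j) ⟩
        (t₁ - t₂) * E k i j                                 ∎) (E-rank≤1 k))

      S+E : Point
      S+E = (λ i j → proj₁ S i j + E k i j) , λ i j → +-cong (proj₂ S i j) (E-sym k i j)

      maximal : ∀ T → ¬ OnLine S k T → ¬ (∀ U → OnLine S k U → Adjacent U T)
      maximal T T∉ all-adjacent = T∉ (B k k , λ i j → begin
        proj₁ T i j              ≈⟨ solve 2 (λ t s → t := s :+ (t :- s)) refl (proj₁ T i j) (proj₁ S i j) ⟩
        proj₁ S i j + B i j      ≈⟨ +-congˡ (*-identityˡ _) ⟨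
        proj₁ S i j + 1# * B i j ≈⟨ +-congˡ (*-congʳ (E-diag k)) ⟨
        proj₁ S i j + E k k k * B i j
          ≈⟨ +-congˡ (rank≤1-pencil (E-sym k) (⊟-sym T S) (E-rank≤1 k) B-rank≤1 B-E-rank≤1
                        (λ Ekkk≈0 → 1≉0 (trans (sym (E-diag k)) Ekkk≈0)) i j) ⟩
        proj₁ S i j + B k k * E k i j ∎)
        where
        B = T ⊟ S
        B-rank≤1 : Rank≤1 B
        B-rank≤1 = near-sym {S} {T} (adjacent⇒near {S} {T}
          (all-adjacent S (0# , λ i j → sym (trans (+-congˡ (zeroˡ _)) (+-identityʳ _)))))
        B-E-rank≤1 : Rank≤1 (B -ᴹ E k)
        B-E-rank≤1 = rank≤1-resp
          (λ i j → solve 3 (λ t s e → (t :- s) :- e := t :- (s :+ e)) refl (proj₁ T i j) (proj₁ S i j) (E k i j))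
          (near-sym {S+E} {T} (adjacent⇒near {S+E} {T}
            (all-adjacent S+E (1# , λ i j → +-congˡ (sym (*-identityˡ _))))))

    -- The 8-cycle lives in the plane of diagonal matrices x E a + y E b: its points are the four
    -- corners of the unit square and its lines are the sides.
    module Square {a b : Fin n} (a≢b : a ≢ b) where

      plane : Carrier → Carrier → Point
      plane x y = (λ i j → x * E a i j + y * E b i j) ,
                  λ i j → +-cong (*-congˡ (E-sym a i j)) (*-congˡ (E-sym b i j))

      plane-a : ∀ x y → proj₁ (plane x y) a a ≈ x
      plane-a x y = begin
        x * E a a a + y * E b a a ≈⟨ +-cong (*-congˡ (E-diag a)) (*-congˡ (E-off a≢b)) ⟩
        x * 1# + y * 0#           ≈⟨ +-cong (*-identityʳ x) (zeroʳ y) ⟩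
        x + 0#                    ≈⟨ +-identityʳ x ⟩
        x                         ∎

      plane-b : ∀ x y → proj₁ (plane x y) b b ≈ y
      plane-b x y = begin
        x * E a b b + y * E b b b ≈⟨ +-cong (*-congˡ (E-off (a≢b ∘ ≡.sym))) (*-congˡ (E-diag b)) ⟩
        x * 0# + y * 1#           ≈⟨ +-cong (zeroʳ x) (*-identityʳ y) ⟩
        0# + y                    ≈⟨ +-identityˡ y ⟩
        y                         ∎

      horizontal : Carrier → Line
      horizontal y = line (plane 0# y) a

      vertical : Carrier → Line
      vertical x = line (plane x 0#) b

      plane∈horizontal : ∀ x y → plane x y ∈ horizontal y
      plane∈horizontal x y = x - 0# , λ i j →
        solve 5 (λ x y x₀ ea eb → x :* ea :+ y :* eb := (x₀ :* ea :+ y :* eb) :+ (x :- x₀) :* ea)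
          refl x y 0# (E a i j) (E b i j)

      plane∈vertical : ∀ x y → plane x y ∈ vertical x
      plane∈vertical x y = y - 0# , λ i j →
        solve 5 (λ x y y₀ ea eb → x :* ea :+ y :* eb := (x :* ea :+ y₀ :* eb) :+ (y :- y₀) :* eb)
          refl x y 0# (E a i j) (E b i j)

      ∈horizontal⇒b : ∀ {T y} → T ∈ horizontal y → proj₁ T b b ≈ y
      ∈horizontal⇒b {T} {y} T∈ = trans (on-line-diag {plane 0# y} {a} {T} T∈ (a≢b ∘ ≡.sym)) (plane-b 0# y)

      ∈vertical⇒a : ∀ {T x} → T ∈ vertical x → proj₁ T a a ≈ x
      ∈vertical⇒a {T} {x} T∈ = trans (on-line-diag {plane x 0#} {b} {T} T∈ a≢b) (plane-a x 0#)

      ⟦_⟧𝔹 : Bool → Carrier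
      ⟦ false ⟧𝔹 = 0#
      ⟦ true ⟧𝔹 = 1#

      ⟦⟧𝔹-injective : ∀ {u v} → ⟦ u ⟧𝔹 ≈ ⟦ v ⟧𝔹 → u ≡ v
      ⟦⟧𝔹-injective {false} {false} _ = ≡.refl
      ⟦⟧𝔹-injective {false} {true} 0≈1 = ⊥-elim (0≉1 0≈1)
      ⟦⟧𝔹-injective {true} {false} 1≈0 = ⊥-elim (1≉0 1≈0)
      ⟦⟧𝔹-injective {true} {true} _ = ≡.refl

      data SquareVertex : Set where
        corner : Bool → Bool → SquareVertex
        side-h side-v : Bool → SquareVertex

      ⟦_⟧ : SquareVertex → Vertex
      ⟦ corner x y ⟧ = inj₁ (plane ⟦ x ⟧𝔹 ⟦ y ⟧𝔹)
      ⟦ side-h y ⟧ = inj₂ (horizontal ⟦ y ⟧𝔹)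
      ⟦ side-v x ⟧ = inj₂ (vertical ⟦ x ⟧𝔹)

      horizontal≉vertical : ∀ {x y} → ¬ horizontal ⟦ y ⟧𝔹 ≈L vertical ⟦ x ⟧𝔹
      horizontal≉vertical {x} {y} h≈v = not-¬ ≡.refl (≡.sym (⟦⟧𝔹-injective {not x} {x} (begin
        ⟦ not x ⟧𝔹                               ≈⟨ plane-a ⟦ not x ⟧𝔹 ⟦ y ⟧𝔹 ⟨
        proj₁ (plane ⟦ not x ⟧𝔹 ⟦ y ⟧𝔹) a a
          ≈⟨ ∈vertical⇒a {plane ⟦ not x ⟧𝔹 ⟦ y ⟧𝔹}
               (proj₁ (h≈v (plane ⟦ not x ⟧𝔹 ⟦ y ⟧𝔹)) (plane∈horizontal ⟦ not x ⟧𝔹 ⟦ y ⟧𝔹)) ⟩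
        ⟦ x ⟧𝔹                                   ∎)))

      ⟦⟧-reflects : ∀ u v → ⟦ u ⟧ ≈V ⟦ v ⟧ → u ≡ v
      ⟦⟧-reflects (corner x y) (corner x′ y′) (lift P≈P′) = ≡.cong₂ corner
        (⟦⟧𝔹-injective {x} {x′} (trans (sym (plane-a _ _)) (trans (P≈P′ a a) (plane-a _ _))))
        (⟦⟧𝔹-injective {y} {y′} (trans (sym (plane-b _ _)) (trans (P≈P′ b b) (plane-b _ _))))
      ⟦⟧-reflects (side-h y) (side-h y′) h≈h′ = ≡.cong side-h (⟦⟧𝔹-injective {y} {y′} (trans
        (sym (plane-b 0# ⟦ y ⟧𝔹))
        (∈horizontal⇒b {plane 0# ⟦ y ⟧𝔹} (proj₁ (h≈h′ (plane 0# ⟦ y ⟧𝔹)) (plane∈horizontal 0# ⟦ y ⟧𝔹)))))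
      ⟦⟧-reflects (side-v x) (side-v x′) v≈v′ = ≡.cong side-v (⟦⟧𝔹-injective {x} {x′} (trans
        (sym (plane-a ⟦ x ⟧𝔹 0#))
        (∈vertical⇒a {plane ⟦ x ⟧𝔹 0#} (proj₁ (v≈v′ (plane ⟦ x ⟧𝔹 0#)) (plane∈vertical ⟦ x ⟧𝔹 0#)))))
      ⟦⟧-reflects (side-h y) (side-v x) h≈v = ⊥-elim (horizontal≉vertical {x} {y} h≈v)
      ⟦⟧-reflects (side-v x) (side-h y) v≈h = ⊥-elim (horizontal≉vertical {x} {y} (swap ∘ v≈h))
      ⟦⟧-reflects (corner _ _) (side-h _) (lift ())
      ⟦⟧-reflects (corner _ _) (side-v _) (lift ())
      ⟦⟧-reflects (side-h _) (corner _ _) (lift ())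
      ⟦⟧-reflects (side-v _) (corner _ _) (lift ())

      square : Fin 8 → SquareVertex
      square = corner false false ∷ side-h false ∷ corner true false ∷ side-v true ∷
               corner true true ∷ side-h true ∷ corner false true ∷ side-v false ∷ []

      position : SquareVertex → Fin 8
      position (corner false false) = 0F
      position (side-h false) = 1F
      position (corner true false) = 2F
      position (side-v true) = 3F
      position (corner true true) = 4F
      position (side-h true) = 5F
      position (corner false true) = 6F
      position (side-v false) = 7F

      position-square : ∀ i → position (square i) ≡ i
      position-square 0F = ≡.refl
      position-square 1F = ≡.refl
      position-square 2F = ≡.refl
      position-square 3F = ≡.refl
      position-square 4F = ≡.refl
      position-square 5F = ≡.refl
      position-square 6F = ≡.refl
      position-square 7F = ≡.refl

      square-edge : ∀ (i : Fin 7) → Edge ⟦ square (Fin.inject₁ i) ⟧ ⟦ square (suc i) ⟧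
      square-edge 0F = plane∈horizontal 0# 0#
      square-edge 1F = plane∈horizontal 1# 0#
      square-edge 2F = plane∈vertical 1# 0#
      square-edge 3F = plane∈vertical 1# 1#
      square-edge 4F = plane∈horizontal 1# 1#
      square-edge 5F = plane∈horizontal 0# 1#
      square-edge 6F = plane∈vertical 0# 1#

      square-cycle : HasCycle 8
      square-cycle = s≤s (s≤s (s≤s z≤n)) , ⟦_⟧ ∘ square , injective , square-edge , plane∈vertical 0# 0#
        where
        injective : ∀ i j → ⟦ square i ⟧ ≈V ⟦ square j ⟧ → i ≡ j
        injective i j eq = ≡.trans (≡.sym (position-square i))
          (≡.trans (≡.cong position (⟦⟧-reflects (square i) (square j) eq)) (position-square j))

module FiniteField {c ℓ} (F : CommutativeRing c ℓ) (isField : IsField F) {q} (card : HasCardinality F q)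
                   (n : ℕ) where
  open CommutativeRing F hiding (zero)
  open DiscreteField F isField (finite⇒decidable F card)
  open Geometry n
  open Sym F n

  ¬¬-shift-Point : DoubleNegationShift (c ⊔ ℓ) _≈P_
  ¬¬-shift-Point = ¬¬-shift-Σ (λ i j → refl) transport shift-Mat
    where
    shift-Carrier : DoubleNegationShift (c ⊔ ℓ) _≈_
    shift-Carrier = ¬¬-shift-surjection (proj₁ card) (proj₂ (proj₂ card))
    shift-Row : DoubleNegationShift (c ⊔ ℓ) (Pointwise _≈_ {n})
    shift-Row = ¬¬-shift-Π {p = ℓ} refl shift-Carrier n
    shift-Mat : DoubleNegationShift (c ⊔ ℓ) (Pointwise (Pointwise _≈_) {n})
    shift-Mat = ¬¬-shift-Π {p = ℓ} (λ i → refl) shift-Row n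
    transport : ∀ {M N : Mat} → Pointwise (Pointwise _≈_) M N → IsSymmetric N → IsSymmetric M
    transport M≈N N-sym i j = trans (M≈N i j) (trans (N-sym i j) (sym (M≈N j i)))

  -- Line membership is not known to be decidable, so each point only gives the two lines'
  -- agreement up to double negation; finiteness of the field lets us collect these.
  lines-meeting-twice : ∀ {L L′ P Q} → P ∈ L → Q ∈ L → P ∈ L′ → Q ∈ L′ → ¬ P ≈P Q → ¬ ¬ L ≈L L′
  lines-meeting-twice {L} {L′} {P} {Q} P∈L Q∈L P∈L′ Q∈L′ P≉Q =
    ¬¬-shift-Point _ resp λ S ¬iff →
      inclusion {L} {L′} P∈L Q∈L P∈L′ Q∈L′ S λ L⊆L′ →
      inclusion {L′} {L} P∈L′ Q∈L′ P∈L Q∈L S λ L′⊆L → ¬iff (L⊆L′ , L′⊆L)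
    where
    resp : (λ S → (S ∈ L → S ∈ L′) × (S ∈ L′ → S ∈ L)) Respects _≈P_
    resp S≈T (L⊆L′ , L′⊆L) =
      (λ T∈L → ∈-resp L′ S≈T (L⊆L′ (∈-resp L (λ i j → sym (S≈T i j)) T∈L))) ,
      (λ T∈L′ → ∈-resp L S≈T (L′⊆L (∈-resp L′ (λ i j → sym (S≈T i j)) T∈L′)))
    inclusion : ∀ {M M′} → P ∈ M → Q ∈ M → P ∈ M′ → Q ∈ M′ → ∀ S → ¬ ¬ (S ∈ M → S ∈ M′)
    inclusion {M} {M′} P∈M Q∈M P∈M′ Q∈M′ S ¬M⊆M′ = ¬M⊆M′ λ S∈M → ⊥-elim
      (line-through M′ P∈M′ Q∈M′ P≉Q (line-near M S∈M P∈M) (line-near M S∈M Q∈M)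
         λ S∈M′ → ¬M⊆M′ λ _ → S∈M′)

  no-triangle : ∀ {L₁ L₂ L₃ X Y W} → X ∈ L₁ → Y ∈ L₁ → Y ∈ L₂ → W ∈ L₂ → W ∈ L₃ → X ∈ L₃ →
    ¬ X ≈P Y → ¬ Y ≈P W → ¬ L₁ ≈L L₂ → ⊥
  no-triangle {L₁} {L₂} {L₃} {X} {Y} {W} X∈L₁ Y∈L₁ Y∈L₂ W∈L₂ W∈L₃ X∈L₃ X≉Y Y≉W L₁≉L₂ =
    line-through L₁ X∈L₁ Y∈L₁ X≉Y (line-near L₃ W∈L₃ X∈L₃) (line-near L₂ W∈L₂ Y∈L₂) λ W∈L₁ →
      lines-meeting-twice {L₁} {L₂} {Y} {W} Y∈L₁ W∈L₁ Y∈L₂ W∈L₂ Y≉W L₁≉L₂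

  data EdgeView : Vertex → Vertex → Set (Level.suc (c ⊔ ℓ)) where
    point-line : ∀ {S L} → S ∈ L → EdgeView (inj₁ S) (inj₂ L)
    line-point : ∀ {L S} → S ∈ L → EdgeView (inj₂ L) (inj₁ S)

  edge-view : ∀ u v → Edge u v → EdgeView u v
  edge-view (inj₁ _) (inj₂ _) S∈L = point-line S∈L
  edge-view (inj₂ _) (inj₁ _) S∈L = line-point S∈L
  edge-view (inj₁ _) (inj₁ _) (lift ())
  edge-view (inj₂ _) (inj₂ _) (lift ())

  no-3-cycle : ∀ {a b c} → EdgeView a b → EdgeView b c → EdgeView c a → ⊥
  no-3-cycle (point-line _) (line-point _) ()
  no-3-cycle (line-point _) (point-line _) ()

  no-5-cycle : ∀ {a b c d e} → EdgeView a b → EdgeView b c → EdgeView c d → EdgeView d e → EdgeView e a → ⊥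
  no-5-cycle (point-line _) (line-point _) (point-line _) (line-point _) ()
  no-5-cycle (line-point _) (point-line _) (line-point _) (point-line _) ()

  no-7-cycle : ∀ {a b c d e f g} → EdgeView a b → EdgeView b c → EdgeView c d → EdgeView d e →
    EdgeView e f → EdgeView f g → EdgeView g a → ⊥
  no-7-cycle (point-line _) (line-point _) (point-line _) (line-point _) (point-line _) (line-point _) ()
  no-7-cycle (line-point _) (point-line _) (line-point _) (point-line _) (line-point _) (point-line _) ()

  no-4-cycle : ∀ {a b c d} → EdgeView a b → EdgeView b c → EdgeView c d → EdgeView d a →
    ¬ a ≈V c → ¬ b ≈V d → ⊥
  no-4-cycle (point-line {P} {L} P∈L) (line-point {_} {Q} Q∈L) (point-line {_} {L′} Q∈L′) (line-point P∈L′)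
             P≉Q L≉L′ =
    lines-meeting-twice {L} {L′} {P} {Q} P∈L Q∈L P∈L′ Q∈L′ (P≉Q ∘ lift) L≉L′
  no-4-cycle (line-point {L} {P} P∈L) (point-line {_} {L′} P∈L′) (line-point {_} {Q} Q∈L′) (point-line Q∈L)
             L≉L′ P≉Q =
    lines-meeting-twice {L} {L′} {P} {Q} P∈L Q∈L P∈L′ Q∈L′ (P≉Q ∘ lift) L≉L′

  no-6-cycle : ∀ {a b c d e f} → EdgeView a b → EdgeView b c → EdgeView c d → EdgeView d e →
    EdgeView e f → EdgeView f a → ¬ a ≈V c → ¬ c ≈V e → ¬ b ≈V d → ¬ d ≈V f → ⊥
  no-6-cycle (point-line {X} {L₁} X∈L₁) (line-point {_} {Y} Y∈L₁) (point-line {_} {L₂} Y∈L₂)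
             (line-point {_} {W} W∈L₂) (point-line {_} {L₃} W∈L₃) (line-point X∈L₃) X≉Y Y≉W L₁≉L₂ _ =
    no-triangle {L₁} {L₂} {L₃} {X} {Y} {W} X∈L₁ Y∈L₁ Y∈L₂ W∈L₂ W∈L₃ X∈L₃ (X≉Y ∘ lift) (Y≉W ∘ lift) L₁≉L₂
  no-6-cycle (line-point {L₁} {X} X∈L₁) (point-line {_} {L₂} X∈L₂) (line-point {_} {Y} Y∈L₂)
             (point-line {_} {L₃} Y∈L₃) (line-point {_} {W} W∈L₃) (point-line W∈L₁) _ L₂≉L₃ X≉Y Y≉W =
    no-triangle {L₂} {L₃} {L₁} {X} {Y} {W} X∈L₂ Y∈L₂ Y∈L₃ W∈L₃ W∈L₁ X∈L₁ (X≉Y ∘ lift) (Y≉W ∘ lift) L₂≉L₃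

  apart : ∀ {k} {v : Fin k → Vertex} → (∀ i j → v i ≈V v j → i ≡ j) → ∀ i j → i ≢ j → ¬ v i ≈V v j
  apart distinct i j i≢j = i≢j ∘ distinct i j

  module _ {m} (v : Fin (ℕ.suc m) → Vertex) where

    step : (∀ i → Edge (v (Fin.inject₁ i)) (v (suc i))) → ∀ i → EdgeView (v (Fin.inject₁ i)) (v (suc i))
    step edge i = edge-view _ _ (edge i)

    close : Edge (v (Fin.fromℕ m)) (v 0F) → EdgeView (v (Fin.fromℕ m)) (v 0F)
    close = edge-view _ _

  no-short-cycle : ∀ k → k ℕ.< 8 → ¬ HasCycle k
  no-short-cycle 0 _ (lift ())
  no-short-cycle 1 _ (s≤s () , _)
  no-short-cycle 2 _ (s≤s (s≤s ()) , _)
  no-short-cycle 3 _ (_ , v , _ , edge , closing) =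
    no-3-cycle (step v edge 0F) (step v edge 1F) (close v closing)
  no-short-cycle 4 _ (_ , v , distinct , edge , closing) =
    no-4-cycle (step v edge 0F) (step v edge 1F) (step v edge 2F) (close v closing)
      (apart distinct 0F 2F λ ()) (apart distinct 1F 3F λ ())
  no-short-cycle 5 _ (_ , v , _ , edge , closing) =
    no-5-cycle (step v edge 0F) (step v edge 1F) (step v edge 2F) (step v edge 3F) (close v closing)
  no-short-cycle 6 _ (_ , v , distinct , edge , closing) =
    no-6-cycle (step v edge 0F) (step v edge 1F) (step v edge 2F) (step v edge 3F) (step v edge 4F)
      (close v closing)
      (apart distinct 0F 2F λ ()) (apart distinct 2F 4F λ ())
      (apart distinct 1F 3F λ ()) (apart distinct 3F 5F λ ())
  no-short-cycle 7 _ (_ , v , _ , edge , closing) =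
    no-7-cycle (step v edge 0F) (step v edge 1F) (step v edge 2F) (step v edge 3F) (step v edge 4F)
      (step v edge 5F) (close v closing)
  no-short-cycle (ℕ.suc (ℕ.suc (ℕ.suc (ℕ.suc (ℕ.suc (ℕ.suc (ℕ.suc (ℕ.suc _))))))))
    (s≤s (s≤s (s≤s (s≤s (s≤s (s≤s (s≤s (s≤s ()))))))))

-- Every finite field has prime-power order.
theorem1 : ∀ {c ℓ} (F : CommutativeRing c ℓ) → IsField F →
    (q : ℕ) → IsPrimePower q → HasCardinality F q →
    (n : ℕ) → 2 ≤ n → Sym.HasGirth F n 8
theorem1 F isField q _ card n@(ℕ.suc (ℕ.suc _)) (s≤s (s≤s z≤n)) = square-cycle , no-short-cycle
  where
  open FiniteField F isField card n using (no-short-cycle)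
  open DiscreteField.Geometry F isField (finite⇒decidable F card) n using (module Square)
  open Square {0F} {1F} (λ ()) using (square-cycle)
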